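{- Let $\mathcal{I}$ be the set of all partial injective functions on $T_{\Sigma}$, and let $\mathcal{P} \subseteq \mathcal{I}$ be the set of partial involutions, i.e. those $f \in \mathcal{I}$ with $f^{\mathsf{op}} = f$ (where $f^{\mathsf{op}}$ is the relational converse of $f$). If $f, g \in \mathcal{P}$, then $!f \in \mathcal{P}$ and the linear application $f \cdot g \in \mathcal{P}$.
   Context: $\Sigma$ is the signature with one constant $\varepsilon$, two unary operation symbols $l, r$, and one binary operation symbol $p$; $T_{\Sigma}$ is the set of ground terms over $\Sigma$. Partial functions are identified with their graphs (binary relations on $T_{\Sigma}$). Relational composition is written in diagrammatic order: $f ; g = \{(x,z) \mid \exists y\, ((x,y) \in f \wedge (y,z) \in g)\}$, and $h^{\ast}$ denotes the reflexive–transitive closure of a relation $h$. Replication: $!f = \{ (p(t,u), p(t,v)) \mid t \in T_{\Sigma},\ (u,v) \in f\}$. Linear application: for $i,j \in \{l,r\}$ put $f_{ij} = \{(u,v) \mid (i(u), j(v)) \in f\}$, and define $f \cdot g = f_{rr} \cup f_{rl} ; g ; (f_{ll} ; g)^{\ast} ; f_{lr}$. -}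

module Defs where

open import Level using (0ℓ)
open import Data.Product using (Σ; ∃; _×_; _,_)
open import Data.Sum using (_⊎_)
open import Relation.Binary.Core using (Rel)
open import Relation.Binary.PropositionalEquality using (_≡_)
open import Relation.Binary.Construct.Closure.ReflexiveTransitive using (Star)

-- Ground terms over Σ = {ε, l, r, p}
data T : Set where
  ε : T
  l : T → T
  r : T → T
  p : T → T → T

-- Binary relations on T (partial functions are identified with their graphs)
Relation : Set₁
Relation = Rel T 0ℓ

_ᵒᵖ : Relation → Relation
(f ᵒᵖ) x y = f y x

_≐_ : Relation → Relation → Set
f ≐ g = (∀ x y → f x y → g x y) × (∀ x y → g x y → f x y)

_∪_ : Relation → Relation → Relation
(f ∪ g) x y = f x y ⊎ g x y

_⨾_ : Relation → Relation → Relation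
(f ⨾ g) x z = ∃ λ y → f x y × g y z

_* : Relation → Relation
h * = Star h

IsPartialFunction : Relation → Set
IsPartialFunction f = ∀ {x y z} → f x y → f x z → y ≡ z

IsPartialInjection : Relation → Set
IsPartialInjection f = IsPartialFunction f × (∀ {x y z} → f x z → f y z → x ≡ y)

IsPartialInvolution : Relation → Set
IsPartialInvolution f = IsPartialInjection f × ((f ᵒᵖ) ≐ f)

! : Relation → Relation
! f x y = Σ T λ t → Σ T λ u → Σ T λ v → (x ≡ p t u) × (y ≡ p t v) × f u v

_[_,_] : Relation → (T → T) → (T → T) → Relation
(f [ i , j ]) u v = f (i u) (j v)

_·_ : Relation → Relation → Relation
f · g = (f [ r , r ]) ∪ ((((f [ r , l ]) ⨾ g) ⨾ (((f [ l , l ]) ⨾ g) *)) ⨾ (f [ l , r ]))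

-- A partial involution is the same thing as a symmetric partial function, and replication
-- visibly preserves both properties. For f · g, symmetry follows from the sliding rule
-- g ; (f_ll ; g)* = (g ; f_ll)* ; g, which lets the path f_rl ; g ; (f_ll ; g)* ; f_lr be read
-- backwards as a path of the same shape. Functionality holds because the loop (f_ll ; g)* is
-- deterministic and can only be left through f_lr, whose domain is disjoint from that of
-- f_ll (and likewise f_rr against f_rl), since l and r build distinct terms.
module Submission where

open import Defs
open import Data.Product using (_×_; _,_)
open import Data.Sum using (inj₁; inj₂)
open import Data.Empty using (⊥; ⊥-elim)
open import Function.Definitions using (Injective)
open import Relation.Binary.Definitions using (Symmetric)
open import Relation.Binary.PropositionalEquality using (_≡_; _≢_; refl; cong)
open import Relation.Binary.Construct.Closure.ReflexiveTransitive using (Star; ε; _◅_; reverse)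

functional∧symmetric⇒involution : ∀ {f} → IsPartialFunction f → Symmetric f → IsPartialInvolution f
functional∧symmetric⇒involution fun sym =
  (fun , λ fxz fyz → fun (sym fxz) (sym fyz)) , (λ _ _ → sym) , (λ _ _ → sym)

involution⇒functional : ∀ {f} → IsPartialInvolution f → IsPartialFunction f
involution⇒functional ((fun , _) , _) = fun

involution⇒symmetric : ∀ {f} → IsPartialInvolution f → Symmetric f
involution⇒symmetric (_ , op⊆f , _) {x} {y} = op⊆f y x

DisjointDomains : Relation → Relation → Set
DisjointDomains f g = ∀ {x y z} → f x y → g x z → ⊥

l-injective : Injective _≡_ _≡_ l
l-injective refl = refl

r-injective : Injective _≡_ _≡_ r
r-injective refl = refl

r≢l : ∀ {u v} → r u ≢ l v
r≢l ()

⨾-assocʳ : ∀ {f g h x y} → ((f ⨾ g) ⨾ h) x y → (f ⨾ (g ⨾ h)) x y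
⨾-assocʳ (y , (x′ , fxx′ , gx′y) , hyz) = x′ , fxx′ , y , gx′y , hyz

⨾-functional : ∀ {f g} → IsPartialFunction f → IsPartialFunction g → IsPartialFunction (f ⨾ g)
⨾-functional funf fung (y , fxy , gyz) (y′ , fxy′ , gy′z′) with funf fxy fxy′
... | refl = fung gyz gy′z′

∪-functional : ∀ {f g} → IsPartialFunction f → IsPartialFunction g → DisjointDomains f g →
               IsPartialFunction (f ∪ g)
∪-functional funf fung disj (inj₁ fxy) (inj₁ fxz) = funf fxy fxz
∪-functional funf fung disj (inj₁ fxy) (inj₂ gxz) = ⊥-elim (disj fxy gxz)
∪-functional funf fung disj (inj₂ gxy) (inj₁ fxz) = ⊥-elim (disj fxz gxy)
∪-functional funf fung disj (inj₂ gxy) (inj₂ gxz) = fung gxy gxz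

-- Two runs take the same steps until one of them exits; disjointness then forces the other to exit too.
*-⨾-functional : ∀ {R E} → IsPartialFunction R → IsPartialFunction E → DisjointDomains E R →
                 IsPartialFunction (Star R ⨾ E)
*-⨾-functional {R} {E} funR funE disj (_ , run , exit) (_ , run′ , exit′) = outcome-unique run exit run′ exit′
  where
  outcome-unique : ∀ {b c c′ z z′} → Star R b c → E c z → Star R b c′ → E c′ z′ → z ≡ z′
  outcome-unique ε e ε e′ = funE e e′
  outcome-unique ε e (step ◅ _) _ = ⊥-elim (disj e step)
  outcome-unique (step ◅ _) _ ε e = ⊥-elim (disj e step)
  outcome-unique (step ◅ steps) e (step′ ◅ steps′) e′ with funR step step′
  ... | refl = outcome-unique steps e steps′ e′

⨾-*-slide : ∀ {A g x y} → (g ⨾ Star (A ⨾ g)) x y → (Star (g ⨾ A) ⨾ g) x y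
⨾-*-slide {A} {g} (_ , gxb , steps) = slide gxb steps
  where
  slide : ∀ {x b y} → g x b → Star (A ⨾ g) b y → (Star (g ⨾ A) ⨾ g) x y
  slide gxy ε = _ , ε , gxy
  slide gxb ((_ , Abm , gmc) ◅ steps) with slide gmc steps
  ... | d , steps′ , gdy = d , (_ , gxb , Abm) ◅ steps′ , gdy

⨾-*-symmetric : ∀ {A g} → Symmetric A → Symmetric g → Symmetric (g ⨾ Star (A ⨾ g))
⨾-*-symmetric symA symg path with ⨾-*-slide path
... | d , steps , gdy = d , symg gdy , reverse (λ (m , gam , Amb) → m , symA Amb , symg gam) steps

component-functional : ∀ {f} {i j : T → T} → IsPartialFunction f → Injective _≡_ _≡_ j →
                       IsPartialFunction (f [ i , j ])
component-functional funf j-injective fuv fuw = j-injective (funf fuv fuw)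

component-disjoint : ∀ {f} {i j k : T → T} → IsPartialFunction f → (∀ {u v} → j u ≢ k v) →
                     DisjointDomains (f [ i , j ]) (f [ i , k ])
component-disjoint funf j≢k fuv fuw = j≢k (funf fuv fuw)

!-functional : ∀ {f} → IsPartialFunction f → IsPartialFunction (! f)
!-functional funf (t , _ , _ , refl , refl , fuv) (_ , _ , _ , refl , refl , fuw) = cong (p t) (funf fuv fuw)

!-symmetric : ∀ {f} → Symmetric f → Symmetric (! f)
!-symmetric symf (t , u , v , refl , refl , fuv) = t , v , u , refl , refl , symf fuv

·-functional : ∀ {f g} → IsPartialFunction f → IsPartialFunction g → IsPartialFunction (f · g)
·-functional {f} {g} funf fung = ∪-functional {direct} direct-functional detour-functional direct-disjoint
  where
  direct entry step exit : Relation
  direct = f [ r , r ]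
  entry = (f [ r , l ]) ⨾ g
  step = (f [ l , l ]) ⨾ g
  exit = f [ l , r ]

  direct-functional : IsPartialFunction direct
  direct-functional = component-functional {f} {r} funf r-injective

  entry-functional : IsPartialFunction entry
  entry-functional = ⨾-functional {f [ r , l ]} (component-functional {f} {r} funf l-injective) fung

  step-functional : IsPartialFunction step
  step-functional = ⨾-functional {f [ l , l ]} (component-functional {f} {l} funf l-injective) fung

  exit-functional : IsPartialFunction exit
  exit-functional = component-functional {f} {l} funf r-injective

  exit-disjoint : DisjointDomains exit step
  exit-disjoint e (_ , continue , _) = component-disjoint {f} {l} {r} {l} funf r≢l e continue

  detour-functional : IsPartialFunction ((entry ⨾ (step *)) ⨾ exit)
  detour-functional path path′ =
    ⨾-functional {entry} entry-functional (*-⨾-functional step-functional exit-functional exit-disjoint)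
      (⨾-assocʳ {entry} {step *} {exit} path) (⨾-assocʳ {entry} {step *} {exit} path′)

  direct-disjoint : DisjointDomains direct ((entry ⨾ (step *)) ⨾ exit)
  direct-disjoint frr (_ , (_ , (_ , frl , _) , _) , _) = component-disjoint {f} {r} {r} {l} funf r≢l frr frl

·-symmetric : ∀ {f g} → Symmetric f → Symmetric g → Symmetric (f · g)
·-symmetric {f} symf symg (inj₁ frr) = inj₁ (symf frr)
·-symmetric {f} symf symg (inj₂ (b , (a′ , (a , frl , gaa′) , loop) , flr))
  with ⨾-*-symmetric {f [ l , l ]} symf symg (a′ , gaa′ , loop)
... | b′ , gbb′ , loop′ = inj₂ (a , (b′ , (b , symf flr , gbb′) , loop′) , symf frl)

mainTheorem1 : (f g : Relation) → IsPartialInvolution f → IsPartialInvolution g → IsPartialInvolution (! f) × IsPartialInvolution (f · g)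
mainTheorem1 f g invf invg =
  functional∧symmetric⇒involution (!-functional funf) (!-symmetric symf) ,
  functional∧symmetric⇒involution (·-functional {f} {g} funf fung) (·-symmetric {f} {g} symf symg)
  where
  funf : IsPartialFunction f
  funf = involution⇒functional invf
  fung : IsPartialFunction g
  fung = involution⇒functional invg
  symf : Symmetric f
  symf = involution⇒symmetric invf
  symg : Symmetric g
  symg = involution⇒symmetric invg
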